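{- For all integers $n\ge 1$ and $k\ge 1$, $\chi_{la}\big((2k)P_2\vee O_{2n+1}\big)=3$.
   Context: For a graph $G$ with $q$ edges, a local antimagic labeling is a bijection $f:E(G)\to\{1,\dots,q\}$ such that, writing $f^+(u)=\sum_{e\ni u}f(e)$, we have $f^+(u)\ne f^+(v)$ for every edge $uv$. $\chi_{la}(G)$ is the minimum over all local antimagic labelings of the number of distinct values of $f^+$. $aP_2$ is the disjoint union of $a$ one-edge paths, $O_m$ is the edgeless graph on $m$ vertices, $\vee$ denotes the join. -}

module Defs where

open import Data.Nat using (ℕ; zero; suc; _+_; _*_; _≤_)
import Data.Nat as ℕ
open import Data.Fin using (Fin; toℕ; splitAt; remQuot; combine; _↑ˡ_; _↑ʳ_)
import Data.Fin as F
open import Data.Fin.Properties using () renaming (_≟_ to _≟ᶠ_)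
open import Data.List using (List; length; map; deduplicate)
open import Data.Nat.ListAction using (sum)
open import Data.List.Base using (allFin)
open import Data.Product using (_×_; _,_; proj₁; proj₂; Σ; ∃)
open import Data.Sum using (inj₁; inj₂)
open import Data.Bool using (if_then_else_; _∨_)
open import Relation.Nullary using (¬_)
open import Relation.Nullary.Decidable using (⌊_⌋)
open import Relation.Binary.PropositionalEquality using (_≡_)
open import Function.Bundles using (_↔_; Inverse)

record Graph : Set where
  field
    p    : ℕ
    q    : ℕ
    ends : Fin q → Fin p × Fin p
open Graph public

-- An edge labeling: a bijection E(G) → {1,…,q}; edge e receives label
-- suc (toℕ (f e)), where f : Fin q ↔ Fin q.
Labeling : Graph → Set
Labeling G = Fin (q G) ↔ Fin (q G)

label : (G : Graph) → Labeling G → Fin (q G) → ℕ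
label G f e = suc (toℕ (Inverse.to f e))

incident : (G : Graph) → Fin (p G) → Fin (q G) → Data.Bool.Bool
incident G u e = ⌊ u ≟ᶠ proj₁ (ends G e) ⌋ ∨ ⌊ u ≟ᶠ proj₂ (ends G e) ⌋

vsum : (G : Graph) → Labeling G → Fin (p G) → ℕ
vsum G f u = sum (map (λ e → if incident G u e then label G f e else 0) (allFin (q G)))

IsLocalAntimagic : (G : Graph) → Labeling G → Set
IsLocalAntimagic G f = (e : Fin (q G)) →
  ¬ (vsum G f (proj₁ (ends G e)) ≡ vsum G f (proj₂ (ends G e)))

numColors : (G : Graph) → Labeling G → ℕ
numColors G f = length (deduplicate ℕ._≟_ (map (vsum G f) (allFin (p G))))

χla≡ : Graph → ℕ → Set
χla≡ G c = Σ (Labeling G) (λ f → IsLocalAntimagic G f × numColors G f ≡ c)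
         × ((f : Labeling G) → IsLocalAntimagic G f → c ≤ numColors G f)

-- Vertices: Fin (a * 2 + m); path vertex (j , b) with
-- j : Fin a, b : Fin 2 is  combine j b ↑ˡ m ; the independent vertex
-- o : Fin m is  (a * 2) ↑ʳ o.
-- Edges: Fin (a + (a * 2) * m); the first a are the P₂ edges
-- (j,0)–(j,1); the rest are all pairs (path vertex x, independent vertex o).
joinPO : ℕ → ℕ → Graph
joinPO a m = record
  { p = a * 2 + m
  ; q = a + (a * 2) * m
  ; ends = λ e → edgeEnds (splitAt a e)
  }
  where
  edgeEnds : Data.Sum._⊎_ (Fin a) (Fin ((a * 2) * m)) → Fin (a * 2 + m) × Fin (a * 2 + m)
  edgeEnds (inj₁ j) = (combine j F.zero ↑ˡ m) , (combine j (F.suc F.zero) ↑ˡ m)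
  edgeEnds (inj₂ t) = (proj₁ (remQuot {a * 2} m t) ↑ˡ m) , ((a * 2) ↑ʳ proj₂ (remQuot {a * 2} m t))

module Submission where

-- Let a ≥ 1 be the number of P₂ edges and m = 2n + 1.  A P₂ edge and any
-- independent vertex span a triangle, so every local antimagic labeling uses at
-- least three colours.  Conversely, label the P₂ edges m·a + 1, …, m·a + a, give
-- the edges from the first ends of the paths to the i-th independent vertex the
-- block a·i + 1, …, a·i + a, and those from the second ends the block of the
-- mirrored index m − 1 − i above m·a + a.  Inside a block the paths come in
-- reverse order for the first n + 1 independent vertices and in order for the
-- last n, which makes the path index cancel: every first end has sum
-- A = (n+1)(2a(n+1)+1), every second end B = A + 2a(n+1)(2n+1), and every
-- independent vertex C = a(a(4n+3)+1), and these are pairwise distinct.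

open import Defs
open import Data.Nat as ℕ using (ℕ; zero; suc; _+_; _*_; _≤_; _<ᵇ_; z≤n; s≤s)
open import Data.Nat.Properties
  using (≤-antisym; m≤n+m; suc-injective; m+1+n≢m; +-*-semiring; +-assoc; *-zeroʳ; +-identityʳ;
         m+[n∸m]≡n; *-cancelˡ-≡; +-cancelʳ-≡)
import Data.Nat.ListAction as List
open import Data.Nat.Divisibility using (_∣_; divides; ∣m+n∣m⇒∣n; m∣m*n)
open import Data.Fin as Fin using (Fin; toℕ; opposite; combine; punchIn; _↑ˡ_; _↑ʳ_)
open import Data.Fin.Patterns using (0F; 1F)
open import Data.Fin.Properties
  using (toℕ<n; opposite-prop; opposite-involutive; toℕ-cast; toℕ-↑ˡ; toℕ-↑ʳ; toℕ-combine; punchInᵢ≢i;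
         +↔⊎; *↔×; splitAt-↑ˡ; splitAt-↑ʳ; remQuot-combine)
  renaming (_≟_ to _≟ᶠ_)
open import Data.Fin.Permutation as Perm using (Permutation′; _⟨$⟩ʳ_; _⟨$⟩ˡ_; reverse; cast-id)
open import Data.List using (List; []; _∷_; length; map; allFin; tabulate; deduplicate)
open import Data.List.Properties using (map-tabulate; length-map)
open import Data.List.Membership.Propositional using (_∈_)
open import Data.List.Membership.Propositional.Properties
  using (∈-map⁺; ∈-map⁻; ∈-allFin; ∈-deduplicate⁺; ∈-deduplicate⁻)
open import Data.List.Relation.Binary.Subset.Propositional using (_⊆_)
open import Data.List.Relation.Unary.Any using (here; there)
open import Data.List.Relation.Unary.All as All using ([]; _∷_)
open import Data.List.Relation.Unary.AllPairs using ([]; _∷_)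
open import Data.List.Relation.Unary.Unique.Propositional using (Unique)
open import Data.List.Relation.Unary.Unique.DecPropositional.Properties ℕ._≟_ using (deduplicate-!)
open import Data.Product using (_×_; _,_; proj₁; proj₂; ∃)
open import Data.Sum using (_⊎_; inj₁; inj₂)
open import Data.Sum.Properties using (inj₂-injective)
open import Algebra.Properties.Semiring.Sum +-*-semiring
  using (sum; sum-syntax; sum-cong-≗; ∑-distrib-+; sum-permute; sum-remove; *-distribˡ-sum)
open import Function using (_∘_; id; flip; case_of_)
open import Function.Bundles using (_↔_; Inverse; mk↔ₛ′)
open import Function.Properties.Inverse using (↔-refl; ↔-sym; ↔-trans)
open import Data.Sum.Function.Propositional using (_⊎-↔_)
open import Data.Product.Function.NonDependent.Propositional using (_×-↔_)
open import Data.Bool using (if_then_else_)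
open import Data.Bool.Properties using (if-float)
open import Relation.Binary.PropositionalEquality
open import Relation.Nullary using (¬_; yes; no; contradiction)
open import Data.Nat.Tactic.RingSolver using (solve-∀)

-- Finite sums

∑-const : ∀ N c → ∑[ i < N ] c ≡ N * c
∑-const zero    c = refl
∑-const (suc N) c = cong (c +_) (∑-const N c)

∑-zero : ∀ N {g : Fin N → ℕ} → (∀ i → g i ≡ 0) → sum g ≡ 0
∑-zero N g≗0 = trans (sum-cong-≗ g≗0) (trans (∑-const N 0) (*-zeroʳ N))

∑-single : ∀ {N} (g : Fin N → ℕ) i₀ → (∀ i → ¬ i ≡ i₀ → g i ≡ 0) → sum g ≡ g i₀
∑-single {suc N} g i₀ g≡0 = begin
  sum g                               ≡⟨ sum-remove {i = i₀} g ⟩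
  g i₀ + ∑[ j < N ] g (punchIn i₀ j)  ≡⟨ cong (g i₀ +_) (∑-zero N λ j → g≡0 _ (punchInᵢ≢i i₀ j)) ⟩
  g i₀ + 0                            ≡⟨ +-identityʳ _ ⟩
  g i₀                                ∎
  where open ≡-Reasoning

∑-+ : ∀ M N (g : Fin (M + N) → ℕ) → sum g ≡ ∑[ i < M ] g (i ↑ˡ N) + ∑[ i < N ] g (M ↑ʳ i)
∑-+ zero    N g = refl
∑-+ (suc M) N g = trans (cong (g Fin.zero +_) (∑-+ M N (g ∘ Fin.suc))) (sym (+-assoc (g Fin.zero) _ _))

∑-* : ∀ M N (g : Fin (M * N) → ℕ) → sum g ≡ ∑[ i < M ] ∑[ j < N ] g (combine i j)
∑-* zero    N g = refl
∑-* (suc M) N g = trans (∑-+ N (M * N) g) (cong (∑[ j < N ] g (j ↑ˡ (M * N)) +_) (∑-* M N (g ∘ (N ↑ʳ_))))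

∑-permute : ∀ {N} (π : Permutation′ N) (g : Fin N → ℕ) → ∑[ i < N ] g (π ⟨$⟩ʳ i) ≡ sum g
∑-permute π g = sym (sum-permute g π)

sum-map-allFin : ∀ N (g : Fin N → ℕ) → List.sum (map g (allFin N)) ≡ sum g
sum-map-allFin N g = trans (cong List.sum (map-tabulate id g)) (sum-tabulate N g)
  where
  sum-tabulate : ∀ N (g : Fin N → ℕ) → List.sum (tabulate g) ≡ sum g
  sum-tabulate zero    g = refl
  sum-tabulate (suc N) g = cong (g Fin.zero +_) (sum-tabulate N (g ∘ Fin.suc))

toℕ+toℕ-opposite : ∀ {N} (i : Fin N) → suc (toℕ i + toℕ (opposite i)) ≡ N
toℕ+toℕ-opposite i = trans (cong (λ k → suc (toℕ i + k)) (opposite-prop i)) (m+[n∸m]≡n (toℕ<n i))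

∑-toℕ : ∀ N → 2 * ∑[ i < N ] toℕ i + N ≡ N * N
∑-toℕ N = begin
  2 * S + N
    ≡⟨ rearrange S N ⟩
  N * 1 + (S + S)
    ≡⟨ cong (λ T → N * 1 + (S + T)) (∑-permute {N} reverse toℕ) ⟨
  N * 1 + (S + ∑[ i < N ] toℕ (opposite i))
    ≡⟨ cong₂ _+_ (∑-const N 1) (∑-distrib-+ {N} toℕ (toℕ ∘ opposite)) ⟨
  ∑[ i < N ] 1 + ∑[ i < N ] (toℕ i + toℕ (opposite i))
    ≡⟨ ∑-distrib-+ {N} (λ _ → 1) (λ i → toℕ i + toℕ (opposite i)) ⟨
  ∑[ i < N ] suc (toℕ i + toℕ (opposite i))
    ≡⟨ sum-cong-≗ {N} toℕ+toℕ-opposite ⟩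
  ∑[ i < N ] N
    ≡⟨ ∑-const N N ⟩
  N * N ∎
  where
  open ≡-Reasoning
  S = ∑[ i < N ] toℕ i
  rearrange : ∀ S N → 2 * S + N ≡ N * 1 + (S + S)
  rearrange = solve-∀

∑-toℕ-odd : ∀ n → ∑[ i < 2 * n + 1 ] toℕ i ≡ n * (2 * n + 1)
∑-toℕ-odd n = *-cancelˡ-≡ _ _ 2 (+-cancelʳ-≡ (2 * n + 1) _ _ (trans (∑-toℕ (2 * n + 1)) (square n)))
  where
  square : ∀ n → (2 * n + 1) * (2 * n + 1) ≡ 2 * (n * (2 * n + 1)) + (2 * n + 1)
  square = solve-∀

∑-threshold : ∀ c d u v → ∑[ i < c + d ] (if toℕ i <ᵇ c then u else v) ≡ c * u + d * v
∑-threshold zero    d u v = ∑-const d v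
∑-threshold (suc c) d u v = trans (cong (u +_) (∑-threshold c d u v)) (sym (+-assoc u (c * u) (d * v)))

∑-affine : ∀ N c x (g h : Fin N → ℕ) → ∑[ i < N ] (c + (x * g i + h i)) ≡ N * c + (x * sum g + sum h)
∑-affine N c x g h = begin
  ∑[ i < N ] (c + (x * g i + h i))
    ≡⟨ ∑-distrib-+ {N} (λ _ → c) (λ i → x * g i + h i) ⟩
  ∑[ i < N ] c + ∑[ i < N ] (x * g i + h i)
    ≡⟨ cong₂ _+_ (∑-const N c) (∑-distrib-+ {N} (λ i → x * g i) h) ⟩
  N * c + (∑[ i < N ] (x * g i) + sum h)
    ≡⟨ cong (λ y → N * c + (y + sum h)) (*-distribˡ-sum x g) ⟨
  N * c + (x * sum g + sum h) ∎
  where open ≡-Reasoning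

-- The three vertex sums

pathSum₀ pathSum₁ indepSum : ℕ → ℕ → ℕ
pathSum₀ a n = suc n * (2 * a * suc n + 1)
pathSum₁ a n = pathSum₀ a n + 2 * a * suc n * suc (2 * n)
indepSum a n = a * (a * (2 * (2 * n + 1) + 1) + 1)

a*x+r≡a*y⇒a∣r : ∀ a x y r → a * x + r ≡ a * y → a ∣ r
a*x+r≡a*y⇒a∣r a x y r eq = ∣m+n∣m⇒∣n (subst (a ∣_) (sym eq) (m∣m*n y)) (m∣m*n x)

suc∣suc⇒quotient : ∀ a′ n → suc a′ ∣ suc n → ∃ λ d → n ≡ a′ + d * suc a′
suc∣suc⇒quotient a′ n (divides (suc d) eq) = d , suc-injective eq

pathSum₀≢pathSum₁ : ∀ a′ n → ¬ pathSum₀ (suc a′) n ≡ pathSum₁ (suc a′) n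
pathSum₀≢pathSum₁ a′ n eq = m+1+n≢m (pathSum₀ (suc a′) n) (sym eq)

-- Both path sums are ≡ n + 1 and indepSum is ≡ 0 modulo a, so equality forces
-- a ∣ n + 1; writing n + 1 = (d + 1) a, the two sides then differ in size.
pathSum₀≢indepSum : ∀ a′ n → ¬ pathSum₀ (suc a′) n ≡ indepSum (suc a′) n
pathSum₀≢indepSum a′ n eq
  with suc∣suc⇒quotient a′ n (a*x+r≡a*y⇒a∣r (suc a′) (2 * suc n * suc n) _ (suc n) (trans (residue a′ n) eq))
  where
  residue : ∀ a′ n → suc a′ * (2 * suc n * suc n) + suc n ≡ suc n * (2 * suc a′ * suc n + 1)
  residue = solve-∀
... | zero  , refl = m+1+n≢m _ (sym (trans eq (gap a′)))
  where
  gap : ∀ a′ → let a = suc a′; n = a′ + 0 * a in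
        a * (a * (2 * (2 * n + 1) + 1) + 1) ≡ suc n * (2 * a * suc n + 1) + a * a * suc (2 * a′)
  gap = solve-∀
... | suc e , refl = m+1+n≢m (indepSum (suc a′) (a′ + suc e * suc a′)) (trans (sym (gap a′ e)) eq)
  where
  gap : ∀ a′ e → let a = suc a′; n = a′ + suc e * a in
        suc n * (2 * a * suc n + 1) ≡ a * (a * (2 * (2 * n + 1) + 1) + 1) + a * suc (e + a + 2 * a * a * suc (suc e) * e)
  gap = solve-∀

pathSum₁≢indepSum : ∀ a′ n → ¬ pathSum₁ (suc a′) n ≡ indepSum (suc a′) n
pathSum₁≢indepSum a′ n eq
  with suc∣suc⇒quotient a′ n
         (a*x+r≡a*y⇒a∣r (suc a′) (2 * suc n * suc n + 2 * suc n * suc (2 * n)) _ (suc n) (trans (residue a′ n) eq))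
  where
  residue : ∀ a′ n → let a = suc a′ in
    a * (2 * suc n * suc n + 2 * suc n * suc (2 * n)) + suc n ≡ suc n * (2 * a * suc n + 1) + 2 * a * suc n * suc (2 * n)
  residue = solve-∀
... | d , refl = m+1+n≢m (indepSum (suc a′) (a′ + d * suc a′)) (trans (sym (gap a′ d)) eq)
  where
  gap : ∀ a′ d → let a = suc a′; n = a′ + d * a in
        suc n * (2 * a * suc n + 1) + 2 * a * suc n * suc (2 * n) ≡
        a * (a * (2 * (2 * n + 1) + 1) + 1) + a * suc (d + a′ + 2 * a * suc d * (a′ * (3 * d + 1) + 3 * d))
  gap = solve-∀

pathSum₀-closed : ∀ {a} n {J J′} → suc (J + J′) ≡ a → let m = 2 * n + 1 in
  suc (m * a + J) + (m * 1 + (a * (n * m) + (suc n * J′ + n * J))) ≡ pathSum₀ a n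
pathSum₀-closed n {J} {J′} refl = identity n J J′
  where
  identity : ∀ n J J′ → let a = suc (J + J′); m = 2 * n + 1 in
    suc (m * a + J) + (m * 1 + (a * (n * m) + (suc n * J′ + n * J))) ≡ suc n * (2 * a * suc n + 1)
  identity = solve-∀

pathSum₁-closed : ∀ {a} n {J J′} → suc (J + J′) ≡ a → let m = 2 * n + 1 in
  suc (m * a + J) + (m * suc (m * a + a) + (a * (n * m) + (suc n * J′ + n * J))) ≡ pathSum₁ a n
pathSum₁-closed n {J} {J′} refl = identity n J J′
  where
  identity : ∀ n J J′ → let a = suc (J + J′); m = 2 * n + 1 in
    suc (m * a + J) + (m * suc (m * a + a) + (a * (n * m) + (suc n * J′ + n * J))) ≡
    suc n * (2 * a * suc n + 1) + 2 * a * suc n * suc (2 * n)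
  identity = solve-∀

indepSum-closed : ∀ {a m} I I′ S → suc (I + I′) ≡ m → 2 * S + a ≡ a * a →
  a * (suc (a * I) + suc (m * a + (a + a * I′))) + (2 * S + 0) ≡ a * (a * (2 * m + 1) + 1)
indepSum-closed {a} I I′ S refl gauss = +-cancelʳ-≡ a _ _ (begin
  a * K + (2 * S + 0) + a                   ≡⟨ shuffle a K S ⟩
  a * K + (2 * S + a)                       ≡⟨ cong (a * K +_) gauss ⟩
  a * K + a * a                             ≡⟨ identity a I I′ ⟩
  a * (a * (2 * suc (I + I′) + 1) + 1) + a  ∎)
  where
  open ≡-Reasoning
  K = suc (a * I) + suc (suc (I + I′) * a + (a + a * I′))
  shuffle : ∀ a K S → a * K + (2 * S + 0) + a ≡ a * K + (2 * S + a)
  shuffle = solve-∀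
  identity : ∀ a I I′ → a * (suc (a * I) + suc (suc (I + I′) * a + (a + a * I′))) + a * a ≡
                        a * (a * (2 * suc (I + I′) + 1) + 1) + a
  identity = solve-∀

Unique⇒length≤ : ∀ {xs ys : List ℕ} → Unique xs → xs ⊆ ys → length xs ≤ length ys
Unique⇒length≤ {[]}     []         _     = z≤n
Unique⇒length≤ {x ∷ xs} (x∉xs ∷ u) xs⊆ys =
  subst (suc (length xs) ≤_) (length-remove (xs⊆ys (here refl)))
    (s≤s (Unique⇒length≤ u λ y∈xs →
      ∈-remove (xs⊆ys (here refl)) (xs⊆ys (there y∈xs)) (All.lookup x∉xs y∈xs)))
  where
  remove : ∀ {w} ys → w ∈ ys → List ℕ
  remove (_ ∷ ys) (here _)  = ys
  remove (y ∷ ys) (there p) = y ∷ remove ys p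

  length-remove : ∀ {w ys} (p : w ∈ ys) → suc (length (remove ys p)) ≡ length ys
  length-remove (here _)  = refl
  length-remove (there p) = cong suc (length-remove p)

  ∈-remove : ∀ {w v ys} (p : w ∈ ys) → v ∈ ys → ¬ w ≡ v → v ∈ remove ys p
  ∈-remove (here refl) (here refl) w≢v = contradiction refl w≢v
  ∈-remove (here _)    (there q)   _   = q
  ∈-remove (there p)   (here v≡y)  _   = here v≡y
  ∈-remove (there p)   (there q)   w≢v = there (∈-remove p q w≢v)

module _ (G : Graph) (f : Labeling G) where

  vertexSums colours : List ℕ
  vertexSums = map (vsum G f) (allFin (p G))
  colours    = deduplicate ℕ._≟_ vertexSums

  vsum∈colours : ∀ u → vsum G f u ∈ colours
  vsum∈colours u = ∈-deduplicate⁺ ℕ._≟_ (∈-map⁺ (vsum G f) (∈-allFin u))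

  numColors≤ : ∀ cs → (∀ u → vsum G f u ∈ cs) → numColors G f ≤ length cs
  numColors≤ cs vsum∈cs = Unique⇒length≤ (deduplicate-! vertexSums) λ c∈colours →
    case ∈-map⁻ (vsum G f) (∈-deduplicate⁻ ℕ._≟_ vertexSums c∈colours) of λ where
      (u , _ , refl) → vsum∈cs u

  ≤numColors : ∀ us → Unique (map (vsum G f) us) → length us ≤ numColors G f
  ≤numColors us unique = subst (_≤ numColors G f) (length-map (vsum G f) us)
    (Unique⇒length≤ unique λ c∈sums → case ∈-map⁻ (vsum G f) c∈sums of λ where
      (u , _ , refl) → vsum∈colours u)

  contribution : Fin (p G) → Fin (q G) → ℕ
  contribution u e = if incident G u e then label G f e else 0

  vsum≡∑contribution : ∀ u → vsum G f u ≡ ∑[ e < q G ] contribution u e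
  vsum≡∑contribution u = sum-map-allFin (q G) (contribution u)

  contribution-end : ∀ {u e} → u ≡ proj₁ (ends G e) ⊎ u ≡ proj₂ (ends G e) →
                     contribution u e ≡ label G f e
  contribution-end {u} {e} end with u ≟ᶠ proj₁ (ends G e) | u ≟ᶠ proj₂ (ends G e) | end
  ... | yes _   | _       | _         = refl
  ... | no _    | yes _   | _         = refl
  ... | no u≢x  | no _    | inj₁ u≡x  = contradiction u≡x u≢x
  ... | no _    | no u≢y  | inj₂ u≡y  = contradiction u≡y u≢y

  contribution-non-end : ∀ {u e} → ¬ u ≡ proj₁ (ends G e) → ¬ u ≡ proj₂ (ends G e) →
                         contribution u e ≡ 0
  contribution-non-end {u} {e} u≢x u≢y with u ≟ᶠ proj₁ (ends G e) | u ≟ᶠ proj₂ (ends G e)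
  ... | yes u≡x | _       = contradiction u≡x u≢x
  ... | no _    | yes u≡y = contradiction u≡y u≢y
  ... | no _    | no _    = refl

-- The graph (a P₂) ∨ O_m

module JoinPO (a m : ℕ) where

  G : Graph
  G = joinPO a m

  Vertex : Set
  Vertex = (Fin a × Fin 2) ⊎ Fin m

  vertex↔ : Fin (p G) ↔ Vertex
  vertex↔ = ↔-trans +↔⊎ (*↔× ⊎-↔ ↔-refl)

  vertex : Vertex → Fin (p G)
  vertex = Inverse.from vertex↔

  vertex-injective : ∀ {v w} → vertex v ≡ vertex w → v ≡ w
  vertex-injective {v} {w} eq = begin
    v                             ≡⟨ Inverse.strictlyInverseˡ vertex↔ v ⟨
    Inverse.to vertex↔ (vertex v) ≡⟨ cong (Inverse.to vertex↔) eq ⟩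
    Inverse.to vertex↔ (vertex w) ≡⟨ Inverse.strictlyInverseˡ vertex↔ w ⟩
    w                             ∎
    where open ≡-Reasoning

  vertex-elim : (P : Fin (p G) → Set) → (∀ v → P (vertex v)) → ∀ u → P u
  vertex-elim P P-vertex u = subst P (Inverse.strictlyInverseʳ vertex↔ u) (P-vertex (Inverse.to vertex↔ u))

  pathVertex : Fin a → Fin 2 → Fin (p G)
  pathVertex j b = vertex (inj₁ (j , b))

  indepVertex : Fin m → Fin (p G)
  indepVertex i = vertex (inj₂ i)

  pathVertex-injective : ∀ {j b j′ b′} → pathVertex j b ≡ pathVertex j′ b′ → j ≡ j′ × b ≡ b′
  pathVertex-injective eq with refl ← vertex-injective {inj₁ _} {inj₁ _} eq = refl , refl

  pathVertex≢indepVertex : ∀ j b i → ¬ pathVertex j b ≡ indepVertex i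
  pathVertex≢indepVertex j b i eq with () ← vertex-injective {inj₁ (j , b)} {inj₂ i} eq

  Edge : Set
  Edge = Fin a ⊎ (Fin a × Fin 2) × Fin m

  edge↔ : Fin (q G) ↔ Edge
  edge↔ = ↔-trans +↔⊎ (↔-refl ⊎-↔ ↔-trans *↔× (*↔× ×-↔ ↔-refl))

  edge : Edge → Fin (q G)
  edge = Inverse.from edge↔

  endpoints : Edge → Fin (p G) × Fin (p G)
  endpoints (inj₁ j)             = pathVertex j 0F , pathVertex j 1F
  endpoints (inj₂ ((j , b) , i)) = pathVertex j b , indepVertex i

  ends-edge : ∀ s → ends G (edge s) ≡ endpoints s
  ends-edge (inj₁ j) rewrite splitAt-↑ˡ a j ((a * 2) * m) = refl
  ends-edge (inj₂ ((j , b) , i))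
    rewrite splitAt-↑ʳ a ((a * 2) * m) (combine (combine j b) i) =
      cong (λ (x , i) → x ↑ˡ m , indepVertex i) (remQuot-combine (combine j b) i)

  module _ (f : Labeling G) where

    contribution-edge-end : ∀ {u} s → u ≡ proj₁ (endpoints s) ⊎ u ≡ proj₂ (endpoints s) →
                            contribution G f u (edge s) ≡ label G f (edge s)
    contribution-edge-end s =
      contribution-end G f ∘ subst (λ ends → _ ≡ proj₁ ends ⊎ _ ≡ proj₂ ends) (sym (ends-edge s))

    contribution-edge-non-end : ∀ {u} s → ¬ u ≡ proj₁ (endpoints s) → ¬ u ≡ proj₂ (endpoints s) →
                                contribution G f u (edge s) ≡ 0
    contribution-edge-non-end s u≢x u≢y = contribution-non-end G f
      (u≢x ∘ flip trans (cong proj₁ (ends-edge s))) (u≢y ∘ flip trans (cong proj₂ (ends-edge s)))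

    vsum-by-edges : ∀ u → vsum G f u ≡
      ∑[ j < a ] contribution G f u (edge (inj₁ j)) +
      ∑[ j < a ] ∑[ b < 2 ] ∑[ i < m ] contribution G f u (edge (inj₂ ((j , b) , i)))
    vsum-by-edges u = begin
      vsum G f u                                          ≡⟨ vsum≡∑contribution G f u ⟩
      ∑[ e < q G ] w e                                    ≡⟨ ∑-+ a ((a * 2) * m) w ⟩
      ∑[ j < a ] w (j ↑ˡ _) + ∑[ t < (a * 2) * m ] w (a ↑ʳ t)
        ≡⟨ cong (∑[ j < a ] w (j ↑ˡ _) +_) (trans (∑-* (a * 2) m (w ∘ (a ↑ʳ_))) (∑-* a 2 _)) ⟩
      _                                                   ∎
      where
      open ≡-Reasoning
      w = contribution G f u

    vsum-pathVertex : ∀ j b → vsum G f (pathVertex j b) ≡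
      label G f (edge (inj₁ j)) + ∑[ i < m ] label G f (edge (inj₂ ((j , b) , i)))
    vsum-pathVertex j b = trans (vsum-by-edges (pathVertex j b)) (cong₂ _+_ pathEdges joinEdges)
      where
      u = pathVertex j b

      pathEdges : ∑[ j′ < a ] contribution G f u (edge (inj₁ j′)) ≡ label G f (edge (inj₁ j))
      pathEdges = trans
        (∑-single _ j λ j′ j′≢j → contribution-edge-non-end (inj₁ j′)
          (j′≢j ∘ sym ∘ proj₁ ∘ pathVertex-injective) (j′≢j ∘ sym ∘ proj₁ ∘ pathVertex-injective))
        (contribution-edge-end (inj₁ j) (end b))
        where
        end : ∀ b → pathVertex j b ≡ pathVertex j 0F ⊎ pathVertex j b ≡ pathVertex j 1F
        end 0F = inj₁ refl
        end 1F = inj₂ refl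

      otherJoinEdge : ∀ j′ b′ i → ¬ (j ≡ j′ × b ≡ b′) →
                      contribution G f u (edge (inj₂ ((j′ , b′) , i))) ≡ 0
      otherJoinEdge j′ b′ i ne = contribution-edge-non-end (inj₂ ((j′ , b′) , i))
        (ne ∘ pathVertex-injective) (pathVertex≢indepVertex j b i)

      joinEdges : ∑[ j′ < a ] ∑[ b′ < 2 ] ∑[ i < m ] contribution G f u (edge (inj₂ ((j′ , b′) , i))) ≡
                  ∑[ i < m ] label G f (edge (inj₂ ((j , b) , i)))
      joinEdges =
        trans (∑-single _ j λ j′ j′≢j → ∑-zero 2 λ b′ → ∑-zero m λ i →
                 otherJoinEdge j′ b′ i (j′≢j ∘ sym ∘ proj₁))
        (trans (∑-single _ b λ b′ b′≢b → ∑-zero m λ i →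
                  otherJoinEdge j b′ i (b′≢b ∘ sym ∘ proj₂))
        (sum-cong-≗ {m} λ i → contribution-edge-end (inj₂ ((j , b) , i)) (inj₁ refl)))

    vsum-indepVertex : ∀ i →
      vsum G f (indepVertex i) ≡ ∑[ j < a ] ∑[ b < 2 ] label G f (edge (inj₂ ((j , b) , i)))
    vsum-indepVertex i = trans (vsum-by-edges (indepVertex i)) (cong₂ _+_
      (∑-zero a λ j → contribution-edge-non-end (inj₁ j)
        (pathVertex≢indepVertex j 0F i ∘ sym) (pathVertex≢indepVertex j 1F i ∘ sym))
      (sum-cong-≗ {a} λ j → sum-cong-≗ {2} λ b →
        trans (∑-single _ i λ i′ i′≢i → contribution-edge-non-end (inj₂ ((j , b) , i′))
                 (pathVertex≢indepVertex j b i ∘ sym) (i′≢i ∘ sym ∘ inj₂-injective ∘ vertex-injective))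
              (contribution-edge-end (inj₂ ((j , b) , i)) (inj₂ refl))))

  Separates : Labeling G → Edge → Set
  Separates g s = ¬ vsum G g (proj₁ (endpoints s)) ≡ vsum G g (proj₂ (endpoints s))

  antimagic⇒separates : ∀ g → IsLocalAntimagic G g → ∀ s → Separates g s
  antimagic⇒separates g antimagic s =
    subst (λ (u , v) → ¬ vsum G g u ≡ vsum G g v) (ends-edge s) (antimagic (edge s))

  separates⇒antimagic : ∀ g → (∀ s → Separates g s) → IsLocalAntimagic G g
  separates⇒antimagic g separates e =
    subst (λ e → ¬ vsum G g (proj₁ (ends G e)) ≡ vsum G g (proj₂ (ends G e)))
      (Inverse.strictlyInverseʳ edge↔ e)
      (subst (λ (u , v) → ¬ vsum G g u ≡ vsum G g v) (sym (ends-edge s)) (separates s))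
    where s = Inverse.to edge↔ e

  3≤numColors : Fin a → Fin m → ∀ g → IsLocalAntimagic G g → 3 ≤ numColors G g
  3≤numColors j i g antimagic =
    ≤numColors G g (pathVertex j 0F ∷ pathVertex j 1F ∷ indepVertex i ∷ [])
      ((separates (inj₁ j) ∷ separates (inj₂ ((j , 0F) , i)) ∷ []) ∷
       (separates (inj₂ ((j , 1F) , i)) ∷ []) ∷ [] ∷ [])
    where
    separates : ∀ s → Separates g s
    separates = antimagic⇒separates g antimagic

-- The labeling

module Construction (a n : ℕ) where

  m : ℕ
  m = 2 * n + 1

  open JoinPO a m

  twist : Fin m → Permutation′ a
  twist i = if toℕ i <ᵇ suc n then reverse else Perm.id

  Slot : Set
  Slot = (Fin m × Fin a) ⊎ (Fin a ⊎ (Fin m × Fin a))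

  blocks↔ : Fin (m * a + (a + m * a)) ↔ Slot
  blocks↔ = ↔-trans +↔⊎ (*↔× ⊎-↔ ↔-trans +↔⊎ (↔-refl ⊎-↔ *↔×))

  slot↔ : Fin (q G) ↔ Slot
  slot↔ = ↔-trans (cast-id (size a m)) blocks↔
    where
    size : ∀ a m → a + (a * 2) * m ≡ m * a + (a + m * a)
    size = solve-∀

  slotIndex : Slot → ℕ
  slotIndex (inj₁ (i , t))        = a * toℕ i + toℕ t
  slotIndex (inj₂ (inj₁ j))       = m * a + toℕ j
  slotIndex (inj₂ (inj₂ (i , t))) = m * a + (a + (a * toℕ i + toℕ t))

  toℕ-slot : ∀ s → toℕ (Inverse.from slot↔ s) ≡ slotIndex s
  toℕ-slot s = trans (toℕ-cast _ _) (position s)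
    where
    position : ∀ s → toℕ (Inverse.from blocks↔ s) ≡ slotIndex s
    position (inj₁ (i , t))        = trans (toℕ-↑ˡ (combine i t) _) (toℕ-combine i t)
    position (inj₂ (inj₁ j))       = trans (toℕ-↑ʳ (m * a) _) (cong (m * a +_) (toℕ-↑ˡ j _))
    position (inj₂ (inj₂ (i , t))) = trans (toℕ-↑ʳ (m * a) _)
      (cong (m * a +_) (trans (toℕ-↑ʳ a _) (cong (a +_) (toℕ-combine i t))))

  assign : Edge ↔ Slot
  assign = mk↔ₛ′ to from to∘from from∘to
    where
    to : Edge → Slot
    to (inj₁ j)              = inj₂ (inj₁ j)
    to (inj₂ ((j , 0F) , i)) = inj₁ (i , twist i ⟨$⟩ʳ j)
    to (inj₂ ((j , 1F) , i)) = inj₂ (inj₂ (opposite i , twist i ⟨$⟩ʳ j))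

    from : Slot → Edge
    from (inj₁ (i , t))         = inj₂ ((twist i ⟨$⟩ˡ t , 0F) , i)
    from (inj₂ (inj₁ j))        = inj₁ j
    from (inj₂ (inj₂ (i′ , t))) = inj₂ ((twist (opposite i′) ⟨$⟩ˡ t , 1F) , opposite i′)

    to∘from : ∀ s → to (from s) ≡ s
    to∘from (inj₁ (i , t))         = cong (λ t → inj₁ (i , t)) (Perm.inverseʳ (twist i))
    to∘from (inj₂ (inj₁ j))        = refl
    to∘from (inj₂ (inj₂ (i′ , t))) = cong₂ (λ i′ t → inj₂ (inj₂ (i′ , t)))
      (opposite-involutive i′) (Perm.inverseʳ (twist (opposite i′)))

    from∘to : ∀ s → from (to s) ≡ s
    from∘to (inj₁ j)              = refl
    from∘to (inj₂ ((j , 0F) , i)) = cong (λ j → inj₂ ((j , 0F) , i)) (Perm.inverseˡ (twist i))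
    from∘to (inj₂ ((j , 1F) , i)) rewrite opposite-involutive i =
      cong (λ j → inj₂ ((j , 1F) , i)) (Perm.inverseˡ (twist i))

  labeling : Labeling G
  labeling = ↔-trans edge↔ (↔-trans assign (↔-sym slot↔))

  label-edge : ∀ s → label G labeling (edge s) ≡ suc (slotIndex (Inverse.to assign s))
  label-edge s = cong suc (trans
    (cong (toℕ ∘ Inverse.from slot↔ ∘ Inverse.to assign) (Inverse.strictlyInverseˡ edge↔ s))
    (toℕ-slot (Inverse.to assign s)))

  toℕ-twist : ∀ i j → toℕ (twist i ⟨$⟩ʳ j) ≡ (if toℕ i <ᵇ suc n then toℕ (opposite j) else toℕ j)
  toℕ-twist i j = if-float (λ π → toℕ (π ⟨$⟩ʳ j)) (toℕ i <ᵇ suc n)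

  ∑-twist : ∀ j → ∑[ i < m ] toℕ (twist i ⟨$⟩ʳ j) ≡ suc n * toℕ (opposite j) + n * toℕ j
  ∑-twist j = begin
    ∑[ i < m ] toℕ (twist i ⟨$⟩ʳ j)        ≡⟨ sum-cong-≗ {m} (λ i → toℕ-twist i j) ⟩
    ∑[ i < m ] threshold (toℕ i)          ≡⟨ cong (λ N → ∑[ i < N ] threshold (toℕ i)) (m≡ n) ⟩
    ∑[ i < suc n + n ] threshold (toℕ i)  ≡⟨ ∑-threshold (suc n) n _ _ ⟩
    suc n * toℕ (opposite j) + n * toℕ j  ∎
    where
    open ≡-Reasoning
    threshold : ℕ → ℕ
    threshold k = if k <ᵇ suc n then toℕ (opposite j) else toℕ j
    m≡ : ∀ n → 2 * n + 1 ≡ suc n + n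
    m≡ = solve-∀

  ∑-joinLabels : ∀ j c (g : Fin m → ℕ) → sum g ≡ n * m →
    ∑[ i < m ] (c + (a * g i + toℕ (twist i ⟨$⟩ʳ j))) ≡
    m * c + (a * (n * m) + (suc n * toℕ (opposite j) + n * toℕ j))
  ∑-joinLabels j c g ∑g = trans (∑-affine m c a g _) (cong₂ (λ S T → m * c + (a * S + T)) ∑g (∑-twist j))

  pathVertex₀-sum : ∀ j → vsum G labeling (pathVertex j 0F) ≡ pathSum₀ a n
  pathVertex₀-sum j = begin
    vsum G labeling (pathVertex j 0F)
      ≡⟨ vsum-pathVertex labeling j 0F ⟩
    label G labeling (edge (inj₁ j)) + ∑[ i < m ] label G labeling (edge (inj₂ ((j , 0F) , i)))
      ≡⟨ cong₂ _+_ (label-edge (inj₁ j)) (sum-cong-≗ {m} λ i → label-edge (inj₂ ((j , 0F) , i))) ⟩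
    suc (m * a + toℕ j) + ∑[ i < m ] suc (a * toℕ i + toℕ (twist i ⟨$⟩ʳ j))
      ≡⟨ cong (suc (m * a + toℕ j) +_) (∑-joinLabels j 1 toℕ (∑-toℕ-odd n)) ⟩
    _ ≡⟨ pathSum₀-closed n (toℕ+toℕ-opposite j) ⟩
    pathSum₀ a n ∎
    where open ≡-Reasoning

  pathVertex₁-sum : ∀ j → vsum G labeling (pathVertex j 1F) ≡ pathSum₁ a n
  pathVertex₁-sum j = begin
    vsum G labeling (pathVertex j 1F)
      ≡⟨ vsum-pathVertex labeling j 1F ⟩
    label G labeling (edge (inj₁ j)) + ∑[ i < m ] label G labeling (edge (inj₂ ((j , 1F) , i)))
      ≡⟨ cong₂ _+_ (label-edge (inj₁ j)) (sum-cong-≗ {m} λ i →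
           trans (label-edge (inj₂ ((j , 1F) , i))) (cong suc (sym (+-assoc (m * a) a _)))) ⟩
    suc (m * a + toℕ j) + ∑[ i < m ] (suc (m * a + a) + (a * toℕ (opposite i) + toℕ (twist i ⟨$⟩ʳ j)))
      ≡⟨ cong (suc (m * a + toℕ j) +_) (∑-joinLabels j (suc (m * a + a)) (toℕ ∘ opposite)
           (trans (∑-permute {m} reverse toℕ) (∑-toℕ-odd n))) ⟩
    _ ≡⟨ pathSum₁-closed n (toℕ+toℕ-opposite j) ⟩
    pathSum₁ a n ∎
    where open ≡-Reasoning

  indepVertex-sum : ∀ i → vsum G labeling (indepVertex i) ≡ indepSum a n
  indepVertex-sum i = begin
    vsum G labeling (indepVertex i)
      ≡⟨ vsum-indepVertex labeling i ⟩
    ∑[ j < a ] ∑[ b < 2 ] label G labeling (edge (inj₂ ((j , b) , i)))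
      ≡⟨ sum-cong-≗ {a} (λ j → trans
           (cong₂ (λ x y → x + (y + 0)) (label-edge (inj₂ ((j , 0F) , i))) (label-edge (inj₂ ((j , 1F) , i))))
           (regroup (a * toℕ i) (m * a) a (a * toℕ (opposite i)) (toℕ (twist i ⟨$⟩ʳ j)))) ⟩
    ∑[ j < a ] (K + (2 * toℕ (twist i ⟨$⟩ʳ j) + 0))
      ≡⟨ ∑-affine a K 2 (λ j → toℕ (twist i ⟨$⟩ʳ j)) (λ _ → 0) ⟩
    a * K + (2 * ∑[ j < a ] toℕ (twist i ⟨$⟩ʳ j) + ∑[ j < a ] 0)
      ≡⟨ cong₂ (λ S Z → a * K + (2 * S + Z)) (∑-permute (twist i) toℕ) (∑-zero a (λ _ → refl)) ⟩
    a * K + (2 * ∑[ j < a ] toℕ j + 0)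
      ≡⟨ indepSum-closed _ _ (∑[ j < a ] toℕ j) (toℕ+toℕ-opposite i) (∑-toℕ a) ⟩
    indepSum a n ∎
    where
    open ≡-Reasoning
    K = suc (a * toℕ i) + suc (m * a + (a + a * toℕ (opposite i)))
    regroup : ∀ x y z w t → suc (x + t) + (suc (y + (z + (w + t))) + 0) ≡ (suc x + suc (y + (z + w))) + (2 * t + 0)
    regroup = solve-∀

χla-aP₂∨O₂ₙ₊₁ : ∀ a′ n → χla≡ (joinPO (suc a′) (2 * n + 1)) 3
χla-aP₂∨O₂ₙ₊₁ a′ n = (labeling , antimagic , colours≡3) , 3≤numColors Fin.zero i₀
  where
  open Construction (suc a′) n
  open JoinPO (suc a′) m

  i₀ : Fin m
  i₀ = Fin.fromℕ< (m≤n+m 1 (2 * n))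

  separated : ∀ {x y x′ y′ : ℕ} → x ≡ x′ → y ≡ y′ → ¬ x′ ≡ y′ → ¬ x ≡ y
  separated refl refl x′≢y′ = x′≢y′

  antimagic : IsLocalAntimagic G labeling
  antimagic = separates⇒antimagic labeling λ where
    (inj₁ j)              → separated (pathVertex₀-sum j) (pathVertex₁-sum j) (pathSum₀≢pathSum₁ a′ n)
    (inj₂ ((j , 0F) , i)) → separated (pathVertex₀-sum j) (indepVertex-sum i) (pathSum₀≢indepSum a′ n)
    (inj₂ ((j , 1F) , i)) → separated (pathVertex₁-sum j) (indepVertex-sum i) (pathSum₁≢indepSum a′ n)

  colours≡3 : numColors G labeling ≡ 3
  colours≡3 = ≤-antisym
    (numColors≤ G labeling (pathSum₀ (suc a′) n ∷ pathSum₁ (suc a′) n ∷ indepSum (suc a′) n ∷ [])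
      (vertex-elim _ λ where
        (inj₁ (j , 0F)) → here (pathVertex₀-sum j)
        (inj₁ (j , 1F)) → there (here (pathVertex₁-sum j))
        (inj₂ i)        → there (there (here (indepVertex-sum i)))))
    (3≤numColors Fin.zero i₀ labeling antimagic)

theorem3p1 : (n k : ℕ) → 1 ≤ n → 1 ≤ k →
    χla≡ (joinPO (2 * k) (2 * n + 1)) 3
theorem3p1 n (suc k) _ _ = χla-aP₂∨O₂ₙ₊₁ _ n
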